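{- Let $\mathbf P=(P,\leq)$ be a poset, $a,b\in P$ with $a\leq b$, $x\in[a,b]$, and let $y$ be a complement of $x$. Assume that $(a,y,b)$ is a modular triple of $\mathbf P$ and that $e$ is the greatest element of $L\big(U(a,y),b\big)=LU\big(a,L(y,b)\big)$. Then the following are equivalent: (i) $e\in R(a,b,x)$; (ii) $L\Big(U\big(a,L(y,b)\big),x\Big)=LU\big(a,L(a,b,x)\big)$ and $L\big(U(x,a,y),b\big)=LU\Big(x,L\big(U(a,y),b\big)\Big)$.
   Context: In a poset $(P,\leq)$, for $A\subseteq P$ let $L(A)=\{p\in P\mid p\leq a\text{ for all }a\in A\}$ and $U(A)=\{p\in P\mid a\leq p\text{ for all }a\in A\}$. One writes $L(a)$ for $L(\{a\})$, $L(a,b,x)$ for $L(\{a,b,x\})$, $L(A,a)$ for $L(A\cup\{a\})$, $U(a,A)$ for $U(\{a\}\cup A)$, $LU(A)$ for $L(U(A))$, and similarly. An element $y$ is a complement of $x$ if $LU(x,y)=UL(x,y)=P$. For $a\leq b$ and $x\in[a,b]$, an element $z\in[a,b]$ is a relative complement of $x$ in $[a,b]$ if $U(x,z)=U(b)$ and $L(x,z)=L(a)$; $R(a,b,x)$ denotes the set of all such relative complements. A triple $(p,q,r)$ of elements of $P$ is a modular triple of $\mathbf P$ if $p\leq r$ and $L\big(U(p,q),r\big)=LU\big(p,L(q,r)\big)$. -}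

module Defs where

open import Level using (Level)
open import Data.Product using (_×_; _,_)
open import Data.Sum using (_⊎_)
open import Data.Unit.Polymorphic using (⊤)
open import Relation.Unary using (Pred; _⊆_; _∪_; _∈_)
open import Relation.Binary.Bundles using (Poset)

module PosetNotions {ℓ : Level} (𝐏 : Poset ℓ ℓ ℓ) where
  open Poset 𝐏 renaming (Carrier to P)

  Sub : Set _
  Sub = Pred P ℓ

  _≐_ : Sub → Sub → Set ℓ
  A ≐ B = (A ⊆ B) × (B ⊆ A)

  ｛_｝ : P → Sub
  ｛ a ｝ p = p ≈ a

  ｛_؛_｝ : P → P → Sub
  ｛ a ؛ b ｝ p = (p ≈ a) ⊎ (p ≈ b)

  ｛_؛_؛_｝ : P → P → P → Sub
  ｛ a ؛ b ؛ c ｝ p = (p ≈ a) ⊎ ((p ≈ b) ⊎ (p ≈ c))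

  Full : Sub
  Full _ = ⊤

  L : Sub → Sub
  L A p = ∀ {q} → q ∈ A → p ≤ q

  U : Sub → Sub
  U A p = ∀ {q} → q ∈ A → q ≤ p

  IsComplement : P → P → Set ℓ
  IsComplement x y = (L (U ｛ x ؛ y ｝) ≐ Full) × (U (L ｛ x ؛ y ｝) ≐ Full)

  InInterval : P → P → P → Set ℓ
  InInterval a b x = (a ≤ x) × (x ≤ b)

  R : P → P → P → Sub
  R a b x z = InInterval a b z × (U ｛ x ؛ z ｝ ≐ U ｛ b ｝) × (L ｛ x ؛ z ｝ ≐ L ｛ a ｝)

  ModularTriple : P → P → P → Set ℓ
  ModularTriple p q r =
    (p ≤ r) × (L (U ｛ p ؛ q ｝ ∪ ｛ r ｝) ≐ L (U (｛ p ｝ ∪ L ｛ q ؛ r ｝)))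

  IsGreatest : Sub → P → Set ℓ
  IsGreatest A e = (e ∈ A) × (∀ {s} → s ∈ A → s ≤ e)

{-# OPTIONS --safe #-}

-- Both conditions of (ii) are cone equations in disguise. As e is the greatest element of the
-- cone L(U(a,y),b), that cone is L(e), and by modularity so is LU(a,L(y,b)); hence the first
-- condition reads L(x,e) = L(a). Since y is a complement of x, b lies below every upper bound
-- of x and y, so the left side of the second condition is L(b), and it reads L(b) = LU(x,e),
-- which by the Galois connection between L and U is U(x,e) = U(b). These two equations are
-- exactly what it means for e ∈ [a,b] to be a relative complement of x in [a,b].
module Submission where

open import Defs
open import Level using (Level)
open import Data.Product using (_×_; _,_; proj₁; proj₂)
open import Data.Product.Function.NonDependent.Propositional using (_×-⇔_)
open import Data.Sum using (inj₁; inj₂)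
open import Data.Unit.Polymorphic using (tt)
open import Function.Bundles using (_⇔_; mk⇔)
open import Function.Properties.Equivalence using () renaming (sym to ⇔-sym; trans to ⇔-trans)
open import Relation.Unary using (_∪_; _∩_; _∈_; _⊆_)
open import Relation.Unary.Algebra using (∩-cong; ∪-comm)
open import Relation.Unary.Properties using (≐-refl; ≐-sym; ≐-trans)
open import Relation.Unary.Relation.Binary.Equality using (≐-setoid)
open import Relation.Binary.Bundles using (Poset)
import Relation.Binary.Reasoning.Setoid as SetoidReasoning

module Cones {ℓ : Level} (𝐏 : Poset ℓ ℓ ℓ) where
  open Poset 𝐏 renaming (Carrier to P)
  open PosetNotions 𝐏
  open SetoidReasoning (≐-setoid P ℓ)

  private variable
    A A′ B B′ : Sub
    p q : P

  ≤⇒∈L｛｝ : q ≤ p → q ∈ L ｛ p ｝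
  ≤⇒∈L｛｝ q≤p r≈p = ≤-respʳ-≈ (Eq.sym r≈p) q≤p

  ∈L｛｝⇒≤ : q ∈ L ｛ p ｝ → q ≤ p
  ∈L｛｝⇒≤ q∈Lp = q∈Lp Eq.refl

  ≤⇒∈U｛｝ : p ≤ q → q ∈ U ｛ p ｝
  ≤⇒∈U｛｝ p≤q r≈p = ≤-respˡ-≈ (Eq.sym r≈p) p≤q

  ∈U｛｝⇒≤ : q ∈ U ｛ p ｝ → p ≤ q
  ∈U｛｝⇒≤ q∈Up = q∈Up Eq.refl

  L-antitone : A ⊆ B → L B ⊆ L A
  L-antitone A⊆B p∈LB q∈A = p∈LB (A⊆B q∈A)

  U-antitone : A ⊆ B → U B ⊆ U A
  U-antitone A⊆B p∈UB q∈A = p∈UB (A⊆B q∈A)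

  L-cong : A ≐ B → L A ≐ L B
  L-cong (A⊆B , B⊆A) = L-antitone B⊆A , L-antitone A⊆B

  U-cong : A ≐ B → U A ≐ U B
  U-cong (A⊆B , B⊆A) = U-antitone B⊆A , U-antitone A⊆B

  L-down : p ≤ q → q ∈ L A → p ∈ L A
  L-down p≤q q∈LA r∈A = trans p≤q (q∈LA r∈A)

  ⊆UL : A ⊆ U (L A)
  ⊆UL p∈A q∈LA = q∈LA p∈A

  ULU≐U : U (L (U A)) ≐ U A
  ULU≐U = (λ p∈ULUA q∈A → p∈ULUA (λ r∈UA → r∈UA q∈A)) , ⊆UL

  LU｛｝≐L｛｝ : L (U ｛ p ｝) ≐ L ｛ p ｝
  LU｛｝≐L｛｝ {p} = (λ q∈LUp → ≤⇒∈L｛｝ (q∈LUp (≤⇒∈U｛｝ (refl {p}))))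
                 , (λ q∈Lp r∈Up → trans (∈L｛｝⇒≤ q∈Lp) (∈U｛｝⇒≤ r∈Up))

  UL｛｝≐U｛｝ : U (L ｛ p ｝) ≐ U ｛ p ｝
  UL｛｝≐U｛｝ {p} = (λ q∈ULp → ≤⇒∈U｛｝ (q∈ULp (≤⇒∈L｛｝ (refl {p}))))
                 , (λ q∈Up r∈Lp → trans (∈L｛｝⇒≤ r∈Lp) (∈U｛｝⇒≤ q∈Up))

  L-∪ : L (A ∪ B) ≐ (L A ∩ L B)
  L-∪ = (λ p∈L → (λ q∈A → p∈L (inj₁ q∈A)) , (λ q∈B → p∈L (inj₂ q∈B)))
      , (λ { (p∈LA , _) (inj₁ q∈A) → p∈LA q∈A ; (_ , p∈LB) (inj₂ q∈B) → p∈LB q∈B })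

  U-∪ : U (A ∪ B) ≐ (U A ∩ U B)
  U-∪ = (λ p∈U → (λ q∈A → p∈U (inj₁ q∈A)) , (λ q∈B → p∈U (inj₂ q∈B)))
      , (λ { (p∈UA , _) (inj₁ q∈A) → p∈UA q∈A ; (_ , p∈UB) (inj₂ q∈B) → p∈UB q∈B })

  L-∪-cong : L A ≐ L A′ → L B ≐ L B′ → L (A ∪ B) ≐ L (A′ ∪ B′)
  L-∪-cong {A} {A′} {B} {B′} LA≐LA′ LB≐LB′ = begin
    L (A ∪ B)     ≈⟨ L-∪ ⟩
    L A ∩ L B     ≈⟨ ∩-cong LA≐LA′ LB≐LB′ ⟩
    L A′ ∩ L B′   ≈⟨ ≐-sym L-∪ ⟩
    L (A′ ∪ B′)   ∎

  U-∪-cong : U A ≐ U A′ → U B ≐ U B′ → U (A ∪ B) ≐ U (A′ ∪ B′)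
  U-∪-cong {A} {A′} {B} {B′} UA≐UA′ UB≐UB′ = begin
    U (A ∪ B)     ≈⟨ U-∪ ⟩
    U A ∩ U B     ≈⟨ ∩-cong UA≐UA′ UB≐UB′ ⟩
    U A′ ∩ U B′   ≈⟨ ≐-sym U-∪ ⟩
    U (A′ ∪ B′)   ∎

  L-∪-absorbʳ : L B ⊆ L A → L (A ∪ B) ≐ L B
  L-∪-absorbʳ LB⊆LA = (λ p∈L → proj₂ (proj₁ L-∪ p∈L))
                    , (λ p∈LB → proj₂ L-∪ (LB⊆LA p∈LB , p∈LB))

  U-∪-absorbˡ : U A ⊆ U B → U (A ∪ B) ≐ U A
  U-∪-absorbˡ UA⊆UB = (λ p∈U → proj₁ (proj₁ U-∪ p∈U))
                    , (λ p∈UA → proj₂ U-∪ (p∈UA , UA⊆UB p∈UA))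

  IsGreatest⇒L≐L｛｝ : ∀ {e} → IsGreatest (L B) e → L B ≐ L ｛ e ｝
  IsGreatest⇒L≐L｛｝ (e∈LB , greatest) = (λ p∈LB → ≤⇒∈L｛｝ (greatest p∈LB))
                                      , (λ p∈Le → L-down (∈L｛｝⇒≤ p∈Le) e∈LB)

  U≐U｛｝⇔L｛｝≐LU : ∀ {b} → (U A ≐ U ｛ b ｝) ⇔ (L ｛ b ｝ ≐ L (U A))
  U≐U｛｝⇔L｛｝≐LU {A} {b} = mk⇔
    (λ UA≐Ub → begin
      L ｛ b ｝       ≈⟨ ≐-sym LU｛｝≐L｛｝ ⟩
      L (U ｛ b ｝)   ≈⟨ L-cong (≐-sym UA≐Ub) ⟩
      L (U A)       ∎)
    (λ Lb≐LUA → begin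
      U A             ≈⟨ ≐-sym ULU≐U ⟩
      U (L (U A))     ≈⟨ U-cong (≐-sym Lb≐LUA) ⟩
      U (L ｛ b ｝)     ≈⟨ UL｛｝≐U｛｝ ⟩
      U ｛ b ｝         ∎)

  ∈⇒U｛｝⊆UL : p ∈ A → U ｛ p ｝ ⊆ U (L A)
  ∈⇒U｛｝⊆UL p∈A q∈Up r∈LA = trans (r∈LA p∈A) (∈U｛｝⇒≤ q∈Up)

  ≐-cong-⇔ : A ≐ A′ → B ≐ B′ → (A ≐ B) ⇔ (A′ ≐ B′)
  ≐-cong-⇔ A≐A′ B≐B′ = mk⇔ (λ A≐B → ≐-trans (≐-sym A≐A′) (≐-trans A≐B B≐B′))
                           (λ A′≐B′ → ≐-trans A≐A′ (≐-trans A′≐B′ (≐-sym B≐B′)))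

  complement⇒≤U : ∀ {x y} → IsComplement x y → q ∈ U ｛ x ؛ y ｝ → p ≤ q
  complement⇒≤U (LUxy≐P , _) q∈Uxy = proj₂ LUxy≐P tt q∈Uxy

  R⇔cones : ∀ {a b x e} → InInterval a b e →
            (e ∈ R a b x) ⇔ ((L ｛ x ؛ e ｝ ≐ L ｛ a ｝) × (U ｛ x ؛ e ｝ ≐ U ｛ b ｝))
  R⇔cones e∈[a,b] = mk⇔ (λ (_ , U≐ , L≐) → L≐ , U≐) (λ (L≐ , U≐) → e∈[a,b] , U≐ , L≐)

theorem7 : {ℓ : Level} (𝐏 : Poset ℓ ℓ ℓ) →
    let open Poset 𝐏 renaming (Carrier to P) in
    let open PosetNotions 𝐏 in
    (a b x y e : P) →
    a ≤ b → InInterval a b x → IsComplement x y →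
    ModularTriple a y b →
    IsGreatest (L (U ｛ a ؛ y ｝ ∪ ｛ b ｝)) e →
    (e ∈ R a b x) ⇔
    ((L (U (｛ a ｝ ∪ L ｛ y ؛ b ｝) ∪ ｛ x ｝) ≐ L (U (｛ a ｝ ∪ L ｛ a ؛ b ؛ x ｝)))
    × (L (U ｛ x ؛ a ؛ y ｝ ∪ ｛ b ｝) ≐ L (U (｛ x ｝ ∪ L (U ｛ a ؛ y ｝ ∪ ｛ b ｝)))))
-- The hypothesis x ∈ [a,b] belongs to the setting of R(a,b,x) but the argument never needs it.
theorem7 𝐏 a b x y e a≤b _ x⊥y (_ , modular) e-greatest =
  ⇔-trans (R⇔cones (a≤e , e≤b)) (⇔-sym (condition₁ ×-⇔ condition₂))
  where
  open Poset 𝐏 renaming (Carrier to P)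
  open PosetNotions 𝐏
  open Cones 𝐏

  e≤b : e ≤ b
  e≤b = proj₁ e-greatest (inj₂ Eq.refl)

  a≤e : a ≤ e
  a≤e = proj₂ e-greatest λ where
    (inj₁ q∈Uay) → q∈Uay (inj₁ Eq.refl)
    (inj₂ q≈b)   → ≤-respʳ-≈ (Eq.sym q≈b) a≤b

  cone≐L｛e｝ : L (U ｛ a ؛ y ｝ ∪ ｛ b ｝) ≐ L ｛ e ｝
  cone≐L｛e｝ = IsGreatest⇒L≐L｛｝ e-greatest

  modularCone≐L｛e｝ : L (U (｛ a ｝ ∪ L ｛ y ؛ b ｝)) ≐ L ｛ e ｝
  modularCone≐L｛e｝ = ≐-trans (≐-sym modular) cone≐L｛e｝

  U｛x؛a؛y｝⊆U｛x؛y｝ : U ｛ x ؛ a ؛ y ｝ ⊆ U ｛ x ؛ y ｝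
  U｛x؛a؛y｝⊆U｛x؛y｝ = U-antitone λ where
    (inj₁ r≈x) → inj₁ r≈x
    (inj₂ r≈y) → inj₂ (inj₂ r≈y)

  b∈LU｛x؛a؛y｝ : b ∈ L (U ｛ x ؛ a ؛ y ｝)
  b∈LU｛x؛a؛y｝ q∈Uxay = complement⇒≤U x⊥y (U｛x؛a؛y｝⊆U｛x؛y｝ q∈Uxay)

  condition₁ : (L (U (｛ a ｝ ∪ L ｛ y ؛ b ｝) ∪ ｛ x ｝) ≐ L (U (｛ a ｝ ∪ L ｛ a ؛ b ؛ x ｝)))
             ⇔ (L ｛ x ؛ e ｝ ≐ L ｛ a ｝)
  condition₁ = ≐-cong-⇔
    (≐-trans (L-∪-cong modularCone≐L｛e｝ ≐-refl) (L-cong (∪-comm ｛ e ｝ ｛ x ｝)))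
    (≐-trans (L-cong (U-∪-absorbˡ (∈⇒U｛｝⊆UL (inj₁ Eq.refl)))) LU｛｝≐L｛｝)

  condition₂ : (L (U ｛ x ؛ a ؛ y ｝ ∪ ｛ b ｝) ≐ L (U (｛ x ｝ ∪ L (U ｛ a ؛ y ｝ ∪ ｛ b ｝))))
             ⇔ (U ｛ x ؛ e ｝ ≐ U ｛ b ｝)
  condition₂ = ⇔-trans
    (≐-cong-⇔
      (L-∪-absorbʳ λ p∈Lb → L-down (∈L｛｝⇒≤ p∈Lb) b∈LU｛x؛a؛y｝)
      (L-cong (U-∪-cong ≐-refl (≐-trans (U-cong cone≐L｛e｝) UL｛｝≐U｛｝))))
    (⇔-sym U≐U｛｝⇔L｛｝≐LU)
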